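{- Let $k\ge 1$. If $m$ is a positive integer with \[ m\equiv \sum_{i=0}^{k+1}4^i+4^{k+1} \pmod{4^{k+2}}, \] then $m\equiv 5\pmod 8$ and the triple $(m,S(m),S^2(m))$ has permutation pattern $(3,1,2)$, i.e. $S(m)<S^2(m)<m$.
   Context: The Syracuse function $S$ on odd positive integers is defined by $S(m)=(3m+1)/2^e$, where $e$ is the largest integer with $2^e\mid 3m+1$. For a triple $(x_1,x_2,x_3)$ of distinct reals with coordinates in increasing order $y_1<y_2<y_3$, its permutation pattern is the permutation $\sigma$ of $\{1,2,3\}$ with $x_i=y_{\sigma(i)}$, written $(\sigma(1),\sigma(2),\sigma(3))$. -}

module Defs where

open import Data.Nat using (ℕ; zero; suc; _+_; _*_; _^_; _<_; _%_)
open import Data.Nat.DivMod using (_/_)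
open import Data.Bool using (Bool; true; false; if_then_else_)
open import Data.Nat.Base using (_≡ᵇ_)
open import Data.Fin using (Fin; zero; suc)
open import Data.Product using (_×_)
open import Relation.Binary.PropositionalEquality using (_≡_; _≢_)
open import Function.Bundles using (_⇔_)

-- Remove all factors of 2, with fuel; fuel n suffices for input n ≥ 1
-- (each step halves), and oddPart 0 = 0 (never used for positive inputs).
oddPartFuel : ℕ → ℕ → ℕ
oddPartFuel zero    n = n
oddPartFuel (suc f) zero = zero
oddPartFuel (suc f) (suc n) =
  if (suc n % 2) ≡ᵇ 0 then oddPartFuel f (suc n / 2) else suc n

oddPart : ℕ → ℕ
oddPart n = oddPartFuel n n

S : ℕ → ℕ
S m = oddPart (3 * m + 1)

sumTo : ℕ → (ℕ → ℕ) → ℕ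
sumTo zero    f = f 0
sumTo (suc n) f = sumTo n f + f (suc n)

triple : ℕ → ℕ → ℕ → Fin 3 → ℕ
triple a b c zero = a
triple a b c (suc zero) = b
triple a b c (suc (suc zero)) = c

-- Permutation pattern: x has distinct coordinates and x_i = y_{σ(i)} where
-- y is the increasing rearrangement; equivalently σ(i) is the rank of x_i,
-- i.e. σ is order-isomorphic to x.
HasPattern : (Fin 3 → ℕ) → (Fin 3 → ℕ) → Set
HasPattern x σ = (∀ i j → i ≢ j → x i ≢ x j) × (∀ i j → (x i < x j) ⇔ (σ i < σ j))

open import Data.Nat.Properties using (m^n≢0)

_≡_[mod4^_] : ℕ → ℕ → ℕ → Set
a ≡ b [mod4^ e ] = _%_ a (4 ^ e) {{m^n≢0 4 e}} ≡ _%_ b (4 ^ e) {{m^n≢0 4 e}}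

-- Summing the geometric series, 3 (Σ_{i≤n} 4^i) + 1 = 4^{n+1}, so every m in the class is
-- m = Σ_{i≤n} 4^i + 4^n + q 4^{n+1} with n = k + 1, and then 3m + 1 = 4^n (12q + 7).
-- Hence S(m) = 12q + 7, 3 S(m) + 1 = 2 (18q + 11) gives S²(m) = 18q + 11, and for n ≥ 2
-- both m ≡ 5 (mod 8) and 18q + 11 < m are immediate from 16 ∣ 4^n.
module Submission where

open import Defs
open import Data.Nat using (ℕ; zero; suc; _+_; _*_; _^_; _<_; _≤_; _%_; z≤n; s≤s; z<s; NonZero)
open import Data.Nat.Properties
open import Data.Nat.DivMod using (_/_; m≡m%n+[m/n]*n; m<n⇒m%n≡m; [m+kn]%n≡m%n; m*n%n≡0; m*n/n≡m)
open import Data.Nat.Tactic.RingSolver using (solve-∀)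
open import Data.Product using (_×_; _,_; ∃)
open import Data.Fin using (zero; suc)
open import Data.Empty using (⊥-elim)
open import Function using (_∘_)
open import Function.Bundles using (_⇔_; mk⇔)
open import Relation.Nullary using (¬_)
open import Relation.Binary.PropositionalEquality

odd⇒nonZero : ∀ {o} → o % 2 ≡ 1 → NonZero o
odd⇒nonZero {suc _} _ = _

1+u*2≡o⇒odd : ∀ u {o} → 1 + u * 2 ≡ o → o % 2 ≡ 1
1+u*2≡o⇒odd u refl = [m+kn]%n≡m%n 1 u 2

n≤2^n : ∀ n → n ≤ 2 ^ n
n≤2^n zero    = z≤n
n≤2^n (suc n) = subst (suc n ≤_) (cong (2 ^ n +_) (sym (+-identityʳ (2 ^ n))))
                      (+-mono-≤ (m^n>0 2 n) (n≤2^n n))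

oddPartFuel-odd : ∀ f {o} → o % 2 ≡ 1 → oddPartFuel f o ≡ o
oddPartFuel-odd zero    _ = refl
oddPartFuel-odd (suc f) {suc n} o%2≡1 rewrite o%2≡1 = refl

oddPartFuel-double : ∀ f x → .{{NonZero x}} → oddPartFuel (suc f) (x * 2) ≡ oddPartFuel f x
oddPartFuel-double f x@(suc _) rewrite m*n%n≡0 x 2 {{_}} | m*n/n≡m x 2 {{_}} = refl

oddPartFuel-2^*odd : ∀ a f {o} → o % 2 ≡ 1 → a ≤ f → oddPartFuel f (2 ^ a * o) ≡ o
oddPartFuel-2^*odd zero f {o} o%2≡1 _ =
  trans (cong (oddPartFuel f) (*-identityˡ o)) (oddPartFuel-odd f o%2≡1)
oddPartFuel-2^*odd (suc a) (suc f) {o} o%2≡1 (s≤s a≤f) = begin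
  oddPartFuel (suc f) (2 ^ suc a * o)   ≡⟨ cong (oddPartFuel (suc f)) 2^[1+a]*o≡x*2 ⟩
  oddPartFuel (suc f) (x * 2)           ≡⟨ oddPartFuel-double f x ⟩
  oddPartFuel f x                       ≡⟨ oddPartFuel-2^*odd a f o%2≡1 a≤f ⟩
  o                                     ∎
  where
  open ≡-Reasoning
  x = 2 ^ a * o
  instance
    _ : NonZero x
    _ = m*n≢0 (2 ^ a) o {{m^n≢0 2 a}} {{odd⇒nonZero o%2≡1}}
  2^[1+a]*o≡x*2 : 2 ^ suc a * o ≡ x * 2
  2^[1+a]*o≡x*2 = trans (*-assoc 2 (2 ^ a) o) (*-comm 2 x)

oddPart-2^*odd : ∀ a {o} → o % 2 ≡ 1 → oddPart (2 ^ a * o) ≡ o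
oddPart-2^*odd a {o} o%2≡1 = oddPartFuel-2^*odd a (2 ^ a * o) o%2≡1 a≤2^a*o
  where
  a≤2^a*o : a ≤ 2 ^ a * o
  a≤2^a*o = ≤-trans (n≤2^n a) (m≤m*n (2 ^ a) o {{odd⇒nonZero o%2≡1}})

3m+1≡2^a*o⇒S≡o : ∀ a m {o} → o % 2 ≡ 1 → 3 * m + 1 ≡ 2 ^ a * o → S m ≡ o
3m+1≡2^a*o⇒S≡o a m o%2≡1 3m+1≡2^a*o = trans (cong oddPart 3m+1≡2^a*o) (oddPart-2^*odd a o%2≡1)

3*sum4^+1≡4^suc : ∀ n → 3 * sumTo n (4 ^_) + 1 ≡ 4 ^ suc n
3*sum4^+1≡4^suc zero    = refl
3*sum4^+1≡4^suc (suc n) = begin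
  3 * (s + 4 ^ suc n) + 1       ≡⟨ regroup s (4 ^ suc n) ⟩
  3 * s + 1 + 3 * 4 ^ suc n     ≡⟨ cong (_+ 3 * 4 ^ suc n) (3*sum4^+1≡4^suc n) ⟩
  4 ^ suc n + 3 * 4 ^ suc n     ≡⟨⟩
  4 ^ suc (suc n)               ∎
  where
  open ≡-Reasoning
  s = sumTo n (4 ^_)
  regroup : ∀ s p → 3 * (s + p) + 1 ≡ 3 * s + 1 + 3 * p
  regroup = solve-∀

sum4^≡5+16* : ∀ n → ∃ λ t → sumTo (suc n) (4 ^_) ≡ 5 + 16 * t
sum4^≡5+16* zero = 0 , refl
sum4^≡5+16* (suc n) with t , s≡5+16t ← sum4^≡5+16* n =
  t + 4 ^ n , trans (cong (_+ 4 ^ suc (suc n)) s≡5+16t) (regroup t (4 ^ n))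
  where
  regroup : ∀ t w → 5 + 16 * t + 4 * (4 * w) ≡ 5 + 16 * (t + w)
  regroup = solve-∀

sum4^+4^<4^suc : ∀ n → sumTo n (4 ^_) + 4 ^ n < 4 ^ suc n
sum4^+4^<4^suc n = *-cancelˡ-< 3 (s + p) (4 * p) (begin-strict
  3 * (s + p)              <⟨ m<m+n (3 * (s + p)) z<s ⟩
  3 * (s + p) + 1          ≡⟨ regroup s p ⟩
  (3 * s + 1) + 3 * p      ≡⟨ cong (_+ 3 * p) (3*sum4^+1≡4^suc n) ⟩
  4 * p + 3 * p            ≤⟨ m≤m+n (4 * p + 3 * p) (5 * p) ⟩
  4 * p + 3 * p + 5 * p    ≡⟨ collect p ⟩
  3 * (4 * p)              ∎)
  where
  open ≤-Reasoning
  s = sumTo n (4 ^_)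
  p = 4 ^ n
  regroup : ∀ s p → 3 * (s + p) + 1 ≡ (3 * s + 1) + 3 * p
  regroup = solve-∀
  collect : ∀ p → 4 * p + 3 * p + 5 * p ≡ 3 * (4 * p)
  collect = solve-∀

%≡%⇒≡+* : ∀ {m r d} .{{_ : NonZero d}} → m % d ≡ r % d → r < d → ∃ λ q → m ≡ r + q * d
%≡%⇒≡+* {m} {r} {d} m%d≡r%d r<d =
  m / d , trans (m≡m%n+[m/n]*n m d) (cong (_+ m / d * d) (trans m%d≡r%d (m<n⇒m%n≡m r<d)))

classMember : ℕ → ℕ → ℕ
classMember n q = sumTo n (4 ^_) + 4 ^ n + q * 4 ^ suc n

≡[mod4^]⇒classMember : ∀ n m → m ≡ sumTo n (4 ^_) + 4 ^ n [mod4^ suc n ] →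
                       ∃ λ q → m ≡ classMember n q
≡[mod4^]⇒classMember n m m≡ = %≡%⇒≡+* {{m^n≢0 4 (suc n)}} m≡ (sum4^+4^<4^suc n)

S-classMember : ∀ n q → S (classMember n q) ≡ 12 * q + 7
S-classMember n q = 3m+1≡2^a*o⇒S≡o (2 * n) (classMember n q) (odd-form q) (begin
  3 * (s + p + q * (4 * p)) + 1       ≡⟨ regroup s p q ⟩
  (3 * s + 1) + 3 * p + 12 * q * p    ≡⟨ cong (λ x → x + 3 * p + 12 * q * p) (3*sum4^+1≡4^suc n) ⟩
  4 * p + 3 * p + 12 * q * p          ≡⟨ factor p q ⟩
  p * (12 * q + 7)                    ≡⟨ cong (_* (12 * q + 7)) (^-*-assoc 2 2 n) ⟩
  2 ^ (2 * n) * (12 * q + 7)          ∎)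
  where
  open ≡-Reasoning
  s = sumTo n (4 ^_)
  p = 4 ^ n
  regroup : ∀ s p q → 3 * (s + p + q * (4 * p)) + 1 ≡ (3 * s + 1) + 3 * p + 12 * q * p
  regroup = solve-∀
  factor : ∀ p q → 4 * p + 3 * p + 12 * q * p ≡ p * (12 * q + 7)
  factor = solve-∀
  odd-form : ∀ q → (12 * q + 7) % 2 ≡ 1
  odd-form q = 1+u*2≡o⇒odd (6 * q + 3) (as-odd q)
    where
    as-odd : ∀ q → 1 + (6 * q + 3) * 2 ≡ 12 * q + 7
    as-odd = solve-∀

S-12q+7 : ∀ q → S (12 * q + 7) ≡ 18 * q + 11
S-12q+7 q = 3m+1≡2^a*o⇒S≡o 1 (12 * q + 7) (1+u*2≡o⇒odd (9 * q + 5) (as-odd q)) (halve q)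
  where
  halve : ∀ q → 3 * (12 * q + 7) + 1 ≡ 2 ^ 1 * (18 * q + 11)
  halve = solve-∀
  as-odd : ∀ q → 1 + (9 * q + 5) * 2 ≡ 18 * q + 11
  as-odd = solve-∀

classMember%8≡5 : ∀ j q → classMember (2 + j) q % 8 ≡ 5
classMember%8≡5 j q =
  let t , s≡5+16t = sum4^≡5+16* (suc j) in
  trans (cong (λ s → (s + 4 ^ (2 + j) + q * 4 ^ (3 + j)) % 8) s≡5+16t)
        (trans (cong (_% 8) (regroup t (4 ^ j) q)) ([m+kn]%n≡m%n 5 (2 * t + 2 * 4 ^ j + 8 * q * 4 ^ j) 8))
  where
  regroup : ∀ t w q → 5 + 16 * t + 4 * (4 * w) + q * (4 * (4 * (4 * w)))
                    ≡ 5 + (2 * t + 2 * w + 8 * q * w) * 8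
  regroup = solve-∀

18q+11<classMember : ∀ j q → 18 * q + 11 < classMember (2 + j) q
18q+11<classMember j q = begin-strict
  18 * q + 11                              ≡⟨ +-comm (18 * q) 11 ⟩
  11 + 18 * q                              <⟨ +-monoˡ-< (18 * q) 11<s+16w ⟩
  s + 16 * w + 18 * q                      ≤⟨ +-monoʳ-≤ (s + 16 * w) 18q≤q*64w ⟩
  s + 16 * w + q * (64 * w)                ≡⟨ cong₂ (λ x y → s + x + q * y) 16w≡4^[2+j] 64w≡4^[3+j] ⟩
  classMember (2 + j) q                    ∎
  where
  open ≤-Reasoning
  s = sumTo (2 + j) (4 ^_)
  w = 4 ^ j
  16w≡4^[2+j] : 16 * w ≡ 4 ^ (2 + j)
  16w≡4^[2+j] = *-assoc 4 4 w
  64w≡4^[3+j] : 64 * w ≡ 4 ^ (3 + j)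
  64w≡4^[3+j] = trans (*-assoc 4 16 w) (cong (4 *_) 16w≡4^[2+j])
  1≤w : 1 ≤ w
  1≤w = m^n>0 4 j
  11<s+16w : 11 < s + 16 * w
  11<s+16w = ≤-trans (m≤m+n 12 4) (≤-trans (*-monoʳ-≤ 16 1≤w) (m≤n+m (16 * w) s))
  18q≤q*64w : 18 * q ≤ q * (64 * w)
  18q≤q*64w = subst (_≤ q * (64 * w)) (*-comm q 18)
                    (*-monoʳ-≤ q (≤-trans (m≤m+n 18 46) (*-monoʳ-≤ 64 1≤w)))

hasPattern312 : ∀ a b c → b < c → c < a → HasPattern (triple a b c) (triple 3 1 2)
hasPattern312 a b c b<c c<a = distinct , order
  where
  b<a : b < a
  b<a = <-trans b<c c<a
  distinct : ∀ i j → i ≢ j → triple a b c i ≢ triple a b c j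
  distinct zero             zero             i≢j = ⊥-elim (i≢j refl)
  distinct zero             (suc zero)       _   = >⇒≢ b<a
  distinct zero             (suc (suc zero)) _   = >⇒≢ c<a
  distinct (suc zero)       zero             _   = <⇒≢ b<a
  distinct (suc zero)       (suc zero)       i≢j = ⊥-elim (i≢j refl)
  distinct (suc zero)       (suc (suc zero)) _   = <⇒≢ b<c
  distinct (suc (suc zero)) zero             _   = <⇒≢ c<a
  distinct (suc (suc zero)) (suc zero)       _   = >⇒≢ b<c
  distinct (suc (suc zero)) (suc (suc zero)) i≢j = ⊥-elim (i≢j refl)
  both : ∀ {x y u v : ℕ} → x < y → u < v → (x < y) ⇔ (u < v)
  both x<y u<v = mk⇔ (λ _ → u<v) (λ _ → x<y)
  neither : ∀ {x y u v : ℕ} → ¬ (x < y) → ¬ (u < v) → (x < y) ⇔ (u < v)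
  neither x≮y u≮v = mk⇔ (⊥-elim ∘ x≮y) (⊥-elim ∘ u≮v)
  order : ∀ i j → (triple a b c i < triple a b c j) ⇔ (triple 3 1 2 i < triple 3 1 2 j)
  order zero             zero             = neither (n≮n a) (n≮n 3)
  order zero             (suc zero)       = neither (<-asym b<a) (<-asym (m≤m+n 2 1))
  order zero             (suc (suc zero)) = neither (<-asym c<a) (<-asym (m≤m+n 3 0))
  order (suc zero)       zero             = both b<a (m≤m+n 2 1)
  order (suc zero)       (suc zero)       = neither (n≮n b) (n≮n 1)
  order (suc zero)       (suc (suc zero)) = both b<c (m≤m+n 2 0)
  order (suc (suc zero)) zero             = both c<a (m≤m+n 3 0)
  order (suc (suc zero)) (suc zero)       = neither (<-asym b<c) (<-asym (m≤m+n 2 0))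
  order (suc (suc zero)) (suc (suc zero)) = neither (n≮n c) (n≮n 2)

Mod8AndPattern312 : ℕ → Set
Mod8AndPattern312 m =
  (m % 8 ≡ 5) × HasPattern (triple m (S m) (S (S m))) (triple 3 1 2) × (S m < S (S m) × S (S m) < m)

classMember-mod8AndPattern312 : ∀ j q → Mod8AndPattern312 (classMember (2 + j) q)
classMember-mod8AndPattern312 j q =
  classMember%8≡5 j q , hasPattern312 m (S m) (S (S m)) Sm<S²m S²m<m , Sm<S²m , S²m<m
  where
  m = classMember (2 + j) q
  Sm≡ : S m ≡ 12 * q + 7
  Sm≡ = S-classMember (2 + j) q
  S²m≡ : S (S m) ≡ 18 * q + 11
  S²m≡ = trans (cong S Sm≡) (S-12q+7 q)
  Sm<S²m : S m < S (S m)
  Sm<S²m = subst₂ _<_ (sym Sm≡) (sym S²m≡) (+-mono-≤-< (*-monoˡ-≤ q (m≤m+n 12 6)) (m≤m+n 8 3))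
  S²m<m : S (S m) < m
  S²m<m = subst (_< m) (sym S²m≡) (18q+11<classMember j q)

mainTheorem8 : (k m : ℕ) → 1 ≤ k → 1 ≤ m →
    m ≡ sumTo (k + 1) (λ i → 4 ^ i) + 4 ^ (k + 1) [mod4^ (k + 2) ] →
    (m % 8 ≡ 5) × HasPattern (triple m (S m) (S (S m))) (triple 3 1 2) × (S m < S (S m) × S (S m) < m)
mainTheorem8 (suc j) m _ _ m≡ rewrite +-comm j 1 | +-comm j 2 =
  let q , m≡classMember = ≡[mod4^]⇒classMember (2 + j) m m≡ in
  subst Mod8AndPattern312 (sym m≡classMember) (classMember-mod8AndPattern312 j q)
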